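{- Let $\lambda$ be a partition and $x=x_1\cdots x_l$ a word in $\mathbf N$. Then \[u_x(\lambda) = \begin{cases} (\lambda_1' + w_1(x), \;\lambda_2' + w_2(x), \;\dots)' & \text{if $\alpha_i(x) \leq \lambda'_i - \lambda'_{i+1}$ for all $i\geq 1$,}\\ 0&\text{otherwise}. \end{cases}\]
   Context: $\lambda'$ denotes the conjugate partition (so $\lambda'_i$ is the number of boxes in column $i$ of the Young diagram of $\lambda$, with $\lambda'_i=0$ for large $i$), and for a nonincreasing sequence $\mu$ of nonnegative integers, $\mu'$ is its conjugate partition. The Schur operator $u_i$ acts linearly on the vector space $\mathbf C[\mathbf Y]$ with basis all partitions by $u_i(\lambda)=\mu$ if the Young diagram of $\mu$ is obtained from that of $\lambda$ by adding one box in column $i$ and $\mu$ is a partition, and $u_i(\lambda)=0$ otherwise; for a word $x=x_1\cdots x_l$, $u_x=u_{x_1}u_{x_2}\cdots u_{x_l}$ (so $u_{x_l}$ acts first). For a word $x$, $w_i(x)$ is the number of occurrences of $i$ in $x$, and $\alpha_i(x)=\max\{w_{i+1}(\tilde x)-w_i(\tilde x) : \tilde x \text{ a suffix of } x\}$, where a suffix is a trailing subword $x_jx_{j+1}\cdots x_l$, possibly empty. -}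

module Defs where

open import Data.Nat using (ℕ; zero; suc; _+_; _∸_; _≤_; _<_; _≥_; _≟_; _≥?_; _⊔_)
open import Data.Integer as ℤ using (ℤ; +_; _-_)
open import Data.List using (List; []; _∷_; length; map; filter; upTo; foldr)
open import Data.List.Relation.Unary.All using (All)
open import Data.List.Relation.Unary.Linked using (Linked; linked?)
open import Data.Maybe using (Maybe; just; nothing; _>>=_)
open import Data.Product using (_×_)
open import Relation.Nullary using (yes; no; does)
open import Data.Bool using (Bool; true; false; _∧_; if_then_else_)

-- Partitions, represented by their (finite) list of row lengths
-- p = (λ₁ , λ₂ , …), nonincreasing, all entries positive.

IsPartition : List ℕ → Set
IsPartition p = Linked _≥_ p × All (0 <_) p

-- r-th row length (1-based), 0 beyond the length of the list
row : ℕ → List ℕ → ℕ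
row _             []       = 0
row zero          _        = 0
row (suc zero)    (a ∷ _)  = a
row (suc (suc r)) (_ ∷ as) = row (suc r) as

-- conjugate: λ'ᵢ = number of boxes in column i = #{ r : λ_r ≥ i }
-- (works for any finite list of naturals; zero entries contribute nothing)
conjAt : List ℕ → ℕ → ℕ
conjAt p i = length (filter (_≥? i) p)

maxList : List ℕ → ℕ
maxList = foldr _⊔_ 0

-- conjugate partition of a finite sequence μ (read as μ followed by zeros):
-- (μ'_1, …, μ'_m) with m = max μ (so μ'_j > 0 for j ≤ m when μ is nonincreasing)
conj : List ℕ → List ℕ
conj μ = map (λ j → conjAt μ (suc j)) (upTo (maxList μ))

-- Schur operators.  An element "partition or 0" of ℂ[Y] in the image of
-- a basis vector under u_x is modelled as Maybe (List ℕ) : nothing = 0.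

-- add one box at the end of row r (0-based); r = length p creates a new row
incrRow : ℕ → List ℕ → List ℕ
incrRow _       []       = 1 ∷ []
incrRow zero    (a ∷ as) = suc a ∷ as
incrRow (suc r) (a ∷ as) = a ∷ incrRow r as

nonincreasing? : List ℕ → Bool
nonincreasing? μ = does (linked? (λ a b → a ≥? b) μ)

-- try rows r = k, k+1, …, k+n (0-based): the added box lies in column i
-- (i.e. the old row r had length i - 1) and the result is a partition
tryRows : ℕ → ℕ → ℕ → List ℕ → Maybe (List ℕ)
tryRows i k zero    p = nothing
tryRows i k (suc n) p =
  if does (suc (row (suc k) p) ≟ i) ∧ nonincreasing? (incrRow k p)
  then just (incrRow k p)
  else tryRows i (suc k) n p

-- u_i(p): the partition obtained by adding one box in column i, or 0.
-- (Any box whose addition yields a Young diagram sits at the end of a row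
--  r ∈ {1, …, ℓ(p)+1}; at most one such r works for a given column.)
u : ℕ → List ℕ → Maybe (List ℕ)
u i p = tryRows i 0 (suc (length p)) p

-- u_x = u_{x₁} u_{x₂} ⋯ u_{x_l}  (u_{x_l} acts first); 0 is absorbing
uWord : List ℕ → List ℕ → Maybe (List ℕ)
uWord []      p = just p
uWord (i ∷ x) p = uWord x p >>= u i

w : ℕ → List ℕ → ℕ
w i x = length (filter (_≟ i) x)

suffixes : List ℕ → List (List ℕ)
suffixes []      = [] ∷ []
suffixes (a ∷ x) = (a ∷ x) ∷ suffixes x

-- α_i(x) = max { w_{i+1}(x̃) - w_i(x̃) : x̃ suffix of x }   (computed in ℤ)
maxℤ : List ℤ → ℤ → ℤ
maxℤ []       m = m
maxℤ (z ∷ zs) m = maxℤ zs (z ℤ.⊔ m)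

α : ℕ → List ℕ → ℤ
α i x with map (λ y → (+ w (suc i) y) - (+ w i y)) (suffixes x)
... | []      = + 0  -- impossible: suffixes is never empty
... | z ∷ zs  = maxℤ zs z

-- the sequence (λ'_1 + w_1(x), λ'_2 + w_2(x), …), truncated after index
-- λ₁ + max x, beyond which all entries are 0
shiftedCols : List ℕ → List ℕ → List ℕ
shiftedCols p x = map (λ j → conjAt p (suc j) + w (suc j) x) (upTo (maxList p + maxList x))

module Submission where

-- A partition λ is handled through its column lengths
-- λ'ᵢ = conjAt λ i.  The argument has four parts.
--  (1) Row/column duality: for a nonincreasing list, row k+1 has length ≥ i
--      iff k < λ'ᵢ.  Hence u_i succeeds on a partition exactly when column i
--      can take a box (i = 1 or λ'ᵢ < λ'ᵢ₋₁), and it then puts the box at the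
--      end of row λ'ᵢ + 1, raising λ'ᵢ by one (`u-adds`, `u-fails`).
--  (2) With dᵢ(y) = wᵢ₊₁(y) - wᵢ(y) we have αᵢ(a x) = max(dᵢ(a x), αᵢ(x)),
--      so the condition of the theorem for a x is the condition for x together
--      with the inequalities dᵢ(a x) ≤ λ'ᵢ - λ'ᵢ₊₁ (`Balanced`, `cond-∷`).
--  (3) Induction on x (`outcome`): either u_x(λ) = 0 and the condition fails,
--      or u_x(λ) is a partition μ with μ'ⱼ = λ'ⱼ + wⱼ(x) and the condition
--      holds; in the step, u_a applies to μ iff the new inequalities hold.
--  (4) A partition is recovered from its columns by conj (`columns-determine`),
--      which identifies μ with (λ'₁ + w₁(x), λ'₂ + w₂(x), …)'.

open import Defs
open import Data.Nat using (ℕ; zero; suc; pred; _+_; _≤_; _<_; _≥_; z≤n; s≤s; s≤s⁻¹)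
open import Data.Nat.Properties
open import Data.Integer as ℤ using (ℤ; +_; _-_; -_; +≤+)
import Data.Integer.Properties as ℤₚ
open import Data.Integer.Solver using (module +-*-Solver)
open +-*-Solver using (solve; _:+_; _:-_; :-_; _:=_)
open import Data.List using (List; []; _∷_; map; length; upTo; applyUpTo)
open import Data.List.Properties using (map-upTo; map-cong)
open import Data.List.Relation.Unary.All as All using (All; []; _∷_)
open import Data.List.Relation.Unary.All.Properties using (applyUpTo⁺₁)
open import Data.List.Relation.Unary.Linked as Linked using (Linked; [-]; _∷_; linked?)
open import Data.Maybe using (just; nothing; _>>=_)
open import Data.Product using (_×_; _,_; Σ)
open import Data.Sum using (_⊎_; inj₁; inj₂)
open import Data.Bool using (Bool; true; false)
open import Data.Empty using (⊥-elim)
open import Relation.Nullary using (¬_; yes; no; does; Dec)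
open import Relation.Nullary.Decidable using (dec-true; dec-false; _⊎-dec_)
open import Relation.Binary.PropositionalEquality
open import Relation.Binary.Definitions using (tri<; tri≈; tri>)
open import Function using (_∘_)

NonInc : List ℕ → Set
NonInc = Linked _≥_

ind : Bool → ℕ
ind true  = 1
ind false = 0

-- Column lengths

conjAt-∷ : ∀ a as j → conjAt (a ∷ as) j ≡ ind (does (a ≥? j)) + conjAt as j
conjAt-∷ a as j with does (a ≥? j)
... | true  = refl
... | false = refl

conjAt-∷-≥ : ∀ {a as j} → j ≤ a → conjAt (a ∷ as) j ≡ suc (conjAt as j)
conjAt-∷-≥ {a} {as} {j} j≤a =
  trans (conjAt-∷ a as j) (cong (λ b → ind b + conjAt as j) (dec-true (a ≥? j) j≤a))

conjAt-∷-< : ∀ {a as j} → ¬ j ≤ a → conjAt (a ∷ as) j ≡ conjAt as j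
conjAt-∷-< {a} {as} {j} j≰a =
  trans (conjAt-∷ a as j) (cong (λ b → ind b + conjAt as j) (dec-false (a ≥? j) j≰a))

conjAt-antitone : ∀ p {i j} → i ≤ j → conjAt p j ≤ conjAt p i
conjAt-antitone [] i≤j = z≤n
conjAt-antitone (a ∷ as) {i} {j} i≤j with j ≤? a | i ≤? a
... | yes j≤a | _ rewrite conjAt-∷-≥ {a} {as} j≤a | conjAt-∷-≥ {a} {as} (≤-trans i≤j j≤a) =
  s≤s (conjAt-antitone as i≤j)
... | no j≰a | yes i≤a rewrite conjAt-∷-< {a} {as} j≰a | conjAt-∷-≥ {a} {as} i≤a =
  m≤n⇒m≤1+n (conjAt-antitone as i≤j)
... | no j≰a | no i≰a rewrite conjAt-∷-< {a} {as} j≰a | conjAt-∷-< {a} {as} i≰a =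
  conjAt-antitone as i≤j

conjAt≤length : ∀ p i → conjAt p i ≤ length p
conjAt≤length [] i = z≤n
conjAt≤length (a ∷ as) i with i ≤? a
... | yes i≤a rewrite conjAt-∷-≥ {a} {as} i≤a = s≤s (conjAt≤length as i)
... | no i≰a rewrite conjAt-∷-< {a} {as} i≰a = m≤n⇒m≤1+n (conjAt≤length as i)

conjAt-1 : ∀ p → All (0 <_) p → conjAt p 1 ≡ length p
conjAt-1 []       []       = refl
conjAt-1 (a ∷ as) (a>0 ∷ ps) = trans (conjAt-∷-≥ {a} {as} a>0) (cong suc (conjAt-1 as ps))

conjAt≡0 : ∀ {j} p → All (_< j) p → conjAt p j ≡ 0
conjAt≡0 []       []         = refl
conjAt≡0 (a ∷ as) (a<j ∷ as<j) = trans (conjAt-∷-< {a} {as} (<⇒≱ a<j)) (conjAt≡0 as as<j)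

conjAt≡0⁻ : ∀ {j} p → conjAt p j ≡ 0 → All (_< j) p
conjAt≡0⁻ []       _ = []
conjAt≡0⁻ {j} (a ∷ as) e with j ≤? a
... | yes j≤a with () ← trans (sym (conjAt-∷-≥ {a} {as} j≤a)) e
... | no j≰a = ≰⇒> j≰a ∷ conjAt≡0⁻ as (trans (sym (conjAt-∷-< {a} {as} j≰a)) e)

-- Row/column duality for nonincreasing lists

head-bounds : ∀ {a as} → NonInc (a ∷ as) → All (_≤ a) as
head-bounds [-]                    = []
head-bounds {a} (b≤a ∷ nonInc) = b≤a ∷ All.map (λ c≤b → ≤-trans c≤b b≤a) (head-bounds nonInc)

row≤head : ∀ {a as} → NonInc (a ∷ as) → ∀ k → row k (a ∷ as) ≤ a
row≤head _               zero          = z≤n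
row≤head _               (suc zero)    = ≤-refl
row≤head [-]             (suc (suc k)) = z≤n
row≤head (b≤a ∷ nonInc)  (suc (suc k)) = ≤-trans (row≤head nonInc (suc k)) b≤a

long-row⇒<conjAt : ∀ {p i} → NonInc p → 1 ≤ i → ∀ k → i ≤ row (suc k) p → k < conjAt p i
long-row⇒<conjAt {[]}     _      i≥1 k i≤row = ⊥-elim (<⇒≱ i≥1 i≤row)
long-row⇒<conjAt {a ∷ as} {i} nonInc i≥1 k i≤row with i ≤? a
... | no i≰a = ⊥-elim (i≰a (≤-trans i≤row (row≤head nonInc (suc k))))
... | yes i≤a rewrite conjAt-∷-≥ {a} {as} i≤a = shift k i≤row
  where
  shift : ∀ k → i ≤ row (suc k) (a ∷ as) → k < suc (conjAt as i)
  shift zero    _     = s≤s z≤n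
  shift (suc k) i≤row = s≤s (long-row⇒<conjAt (Linked.tail nonInc) i≥1 k i≤row)

<conjAt⇒long-row : ∀ {p i} → NonInc p → ∀ k → k < conjAt p i → i ≤ row (suc k) p
<conjAt⇒long-row {[]}     _ k ()
<conjAt⇒long-row {a ∷ as} {i} nonInc k k<λ'ᵢ with i ≤? a
... | yes i≤a rewrite conjAt-∷-≥ {a} {as} i≤a = shift k k<λ'ᵢ
  where
  shift : ∀ k → k < suc (conjAt as i) → i ≤ row (suc k) (a ∷ as)
  shift zero    _           = i≤a
  shift (suc k) (s≤s k<λ'ᵢ) = <conjAt⇒long-row (Linked.tail nonInc) k k<λ'ᵢ
... | no i≰a rewrite conjAt-∷-< {a} {as} i≰a
                   | conjAt≡0 {i} as (All.map (λ b≤a → ≤-<-trans b≤a (≰⇒> i≰a)) (head-bounds nonInc)) =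
  ⊥-elim (<⇒≱ k<λ'ᵢ z≤n)

-- Adding a box at the end of a row

δ : ℕ → ℕ → ℕ
δ a j = ind (does (a ≟ j))

δ-≡ : ∀ a → δ a a ≡ 1
δ-≡ a = cong ind (dec-true (a ≟ a) refl)

δ-≢ : ∀ {a j} → a ≢ j → δ a j ≡ 0
δ-≢ {a} {j} a≢j = cong ind (dec-false (a ≟ j) a≢j)

conjAt-incrRow : ∀ k p j →
  conjAt (incrRow k p) (suc j) ≡ conjAt p (suc j) + δ (suc (row (suc k) p)) (suc j)
conjAt-incrRow k [] zero    = refl
conjAt-incrRow k [] (suc j) = refl
conjAt-incrRow zero (a ∷ as) j with <-cmp a j
... | tri< a<j _ _
  rewrite conjAt-∷-< {suc a} {as} {suc j} (<⇒≱ (s≤s a<j))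
        | conjAt-∷-< {a} {as} {suc j} (<⇒≱ (m<n⇒m<1+n a<j))
        | δ-≢ {suc a} {suc j} (<⇒≢ (s≤s a<j)) = sym (+-identityʳ _)
... | tri≈ _ refl _
  rewrite conjAt-∷-≥ {suc a} {as} {suc a} ≤-refl
        | conjAt-∷-< {a} {as} {suc a} (<⇒≱ ≤-refl)
        | δ-≡ (suc a) = +-comm 1 _
... | tri> _ _ j<a
  rewrite conjAt-∷-≥ {suc a} {as} {suc j} (m<n⇒m<1+n j<a)
        | conjAt-∷-≥ {a} {as} {suc j} j<a
        | δ-≢ {suc a} {suc j} (≢-sym (<⇒≢ (s≤s j<a))) = sym (+-identityʳ _)
conjAt-incrRow (suc k) (a ∷ as) j
  rewrite conjAt-∷ a (incrRow k as) (suc j) | conjAt-∷ a as (suc j) | conjAt-incrRow k as j =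
  sym (+-assoc (ind (does (a ≥? suc j))) _ _)

incrRow-positive : ∀ k p → All (0 <_) p → All (0 <_) (incrRow k p)
incrRow-positive k       []       []         = s≤s z≤n ∷ []
incrRow-positive zero    (a ∷ as) (_ ∷ ps)   = s≤s z≤n ∷ ps
incrRow-positive (suc k) (a ∷ as) (a>0 ∷ ps) = a>0 ∷ incrRow-positive k as ps

incrRow₀-nonInc : ∀ p → NonInc p → NonInc (incrRow 0 p)
incrRow₀-nonInc []           _             = [-]
incrRow₀-nonInc (a ∷ [])     _             = [-]
incrRow₀-nonInc (a ∷ b ∷ bs) (b≤a ∷ nonInc) = m≤n⇒m≤1+n b≤a ∷ nonInc

incrRowₛ-nonInc : ∀ k p → NonInc p → row (suc (suc k)) p < row (suc k) p →
  NonInc (incrRow (suc k) p)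
incrRowₛ-nonInc k       []           _              _ = [-]
incrRowₛ-nonInc zero    (a ∷ [])     _              r<a = r<a ∷ [-]
incrRowₛ-nonInc zero    (a ∷ b ∷ bs) nonInc         b<a = b<a ∷ incrRow₀-nonInc (b ∷ bs) (Linked.tail nonInc)
incrRowₛ-nonInc (suc k) (a ∷ [])     _              ()
incrRowₛ-nonInc (suc k) (a ∷ b ∷ bs) (b≤a ∷ nonInc) r<r' = b≤a ∷ incrRowₛ-nonInc k (b ∷ bs) nonInc r<r'

incrRow-nonInc : ∀ {p i} c → NonInc p → (∀ k → k < c → i ≤ row (suc k) p) →
  suc (row (suc c) p) ≡ i → NonInc (incrRow c p)
incrRow-nonInc {p} zero    nonInc _     _   = incrRow₀-nonInc p nonInc
incrRow-nonInc {p} (suc c) nonInc above hit =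
  incrRowₛ-nonInc c p nonInc (≤-trans (≤-reflexive hit) (above c ≤-refl))

-- A single Schur operator

Addable : ℕ → List ℕ → Set
Addable i p = (i ≡ 1) ⊎ (conjAt p i < conjAt p (pred i))

addable? : ∀ i p → Dec (Addable i p)
addable? i p = (i ≟ 1) ⊎-dec (conjAt p i <? conjAt p (pred i))

addable⇒row-reaches : ∀ {p} i → NonInc p → Addable i p → i ≤ suc (row (suc (conjAt p i)) p)
addable⇒row-reaches i       _      (inj₁ refl)       = s≤s z≤n
addable⇒row-reaches zero    _      (inj₂ _)          = z≤n
addable⇒row-reaches (suc i) nonInc (inj₂ λ'ᵢ<λ'ᵢ₋₁) = s≤s (<conjAt⇒long-row nonInc _ λ'ᵢ<λ'ᵢ₋₁)

addable⇒row-length : ∀ {p i} → NonInc p → 1 ≤ i → Addable i p →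
  suc (row (suc (conjAt p i)) p) ≡ i
addable⇒row-length {p} {i} nonInc i≥1 addable = ≤-antisym upper (addable⇒row-reaches i nonInc addable)
  where
  upper : suc (row (suc (conjAt p i)) p) ≤ i
  upper with i ≤? row (suc (conjAt p i)) p
  ... | yes i≤r = ⊥-elim (<-irrefl refl (long-row⇒<conjAt nonInc i≥1 (conjAt p i) i≤r))
  ... | no i≰r  = ≰⇒> i≰r

¬addable⇒no-row-length : ∀ {p i} → NonInc p → ¬ Addable i p → ∀ k → suc (row (suc k) p) ≢ i
¬addable⇒no-row-length {p} {suc zero}    _      ¬addable k _   = ¬addable (inj₁ refl)
¬addable⇒no-row-length {p} {suc (suc i)} nonInc ¬addable k hit =
  <-irrefl refl (subst (suc (suc i) ≤_) (suc-injective hit) (<conjAt⇒long-row nonInc k k<λ'ᵢ₊₁))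
  where
  λ'ᵢ≤λ'ᵢ₊₁ : conjAt p (suc i) ≤ conjAt p (suc (suc i))
  λ'ᵢ≤λ'ᵢ₊₁ with conjAt p (suc (suc i)) <? conjAt p (suc i)
  ... | yes lt = ⊥-elim (¬addable (inj₂ lt))
  ... | no ¬lt = ≮⇒≥ ¬lt
  k<λ'ᵢ₊₁ : k < conjAt p (suc (suc i))
  k<λ'ᵢ₊₁ = <-≤-trans (long-row⇒<conjAt nonInc (s≤s z≤n) k (≤-reflexive (sym (suc-injective hit)))) λ'ᵢ≤λ'ᵢ₊₁

tryRows-none : ∀ {i p} n k → (∀ k' → suc (row (suc k') p) ≢ i) → tryRows i k n p ≡ nothing
tryRows-none           zero    k _        = refl
tryRows-none {i} {p} (suc n) k no-row
  rewrite dec-false (suc (row (suc k) p) ≟ i) (no-row k) = tryRows-none n (suc k) no-row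

tryRows-first : ∀ {i p c} n k → k ≤ c → c < k + n → (∀ k' → k' < c → suc (row (suc k') p) ≢ i) →
  suc (row (suc c) p) ≡ i → nonincreasing? (incrRow c p) ≡ true → tryRows i k n p ≡ just (incrRow c p)
tryRows-first zero k k≤c c<k+0 _ _ _ = ⊥-elim (<⇒≱ c<k+0 (subst (_≤ _) (sym (+-identityʳ k)) k≤c))
tryRows-first {i} {p} {c} (suc n) k k≤c c<k+n earlier hit legal with k ≟ c
... | yes refl rewrite dec-true (suc (row (suc k) p) ≟ i) hit | legal = refl
... | no k≢c rewrite dec-false (suc (row (suc k) p) ≟ i) (earlier k (≤∧≢⇒< k≤c k≢c)) =
  tryRows-first n (suc k) (≤∧≢⇒< k≤c k≢c) (subst (c <_) (+-suc k n) c<k+n) earlier hit legal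

u-adds : ∀ {p i} → IsPartition p → 1 ≤ i → Addable i p →
  Σ (List ℕ) λ q → u i p ≡ just q × IsPartition q × (∀ j → conjAt q (suc j) ≡ conjAt p (suc j) + δ i (suc j))
u-adds {p} {i} (nonInc , positive) i≥1 addable =
  incrRow c p ,
  tryRows-first (suc (length p)) 0 z≤n (s≤s (conjAt≤length p i)) earlier hit legal ,
  (nonInc′ , incrRow-positive c p positive) ,
  λ j → trans (conjAt-incrRow c p j) (cong (λ r → conjAt p (suc j) + δ r (suc j)) hit)
  where
  c = conjAt p i
  hit : suc (row (suc c) p) ≡ i
  hit = addable⇒row-length nonInc i≥1 addable
  above : ∀ k → k < c → i ≤ row (suc k) p
  above = <conjAt⇒long-row nonInc
  earlier : ∀ k → k < c → suc (row (suc k) p) ≢ i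
  earlier k k<c e = <-irrefl refl (subst (_≤ row (suc k) p) (sym e) (above k k<c))
  nonInc′ : NonInc (incrRow c p)
  nonInc′ = incrRow-nonInc c nonInc above hit
  legal : nonincreasing? (incrRow c p) ≡ true
  legal = dec-true (linked? (λ a b → a ≥? b) (incrRow c p)) nonInc′

u-fails : ∀ {p i} → IsPartition p → ¬ Addable i p → u i p ≡ nothing
u-fails {p} (nonInc , _) ¬addable = tryRows-none (suc (length p)) 0 (¬addable⇒no-row-length nonInc ¬addable)

-- Word statistics

w-∷ : ∀ j a x → w j (a ∷ x) ≡ δ a j + w j x
w-∷ j a x with does (a ≟ j)
... | true  = refl
... | false = refl

diff≤diff⇒ : ∀ A B C D → (+ A) - (+ B) ℤ.≤ (+ C) - (+ D) → A + D ≤ C + B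
diff≤diff⇒ A B C D h = ℤₚ.drop‿+≤+ (subst₂ ℤ._≤_
    (trans (cancel (+ A) (+ B) (+ D)) (sym (ℤₚ.pos-+ A D)))
    (trans (cong (λ z → (+ C - + D) ℤ.+ z) (ℤₚ.+-comm (+ B) (+ D)))
           (trans (cancel (+ C) (+ D) (+ B)) (sym (ℤₚ.pos-+ C B))))
    (ℤₚ.+-monoˡ-≤ (+ B ℤ.+ + D) h))
  where
  cancel : ∀ (a b d : ℤ) → (a - b) ℤ.+ (b ℤ.+ d) ≡ a ℤ.+ d
  cancel = solve 3 (λ a b d → (a :- b) :+ (b :+ d) := a :+ d) refl

⇒diff≤diff : ∀ A B C D → A + D ≤ C + B → (+ A) - (+ B) ℤ.≤ (+ C) - (+ D)
⇒diff≤diff A B C D h = subst₂ ℤ._≤_ (cancelʳ (+ A) (+ B) (+ D)) (cancelˡ (+ C) (+ B) (+ D))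
  (ℤₚ.+-monoˡ-≤ (- (+ B) - (+ D)) (subst₂ ℤ._≤_ (ℤₚ.pos-+ A D) (ℤₚ.pos-+ C B) (+≤+ h)))
  where
  cancelʳ : ∀ (a b d : ℤ) → (a ℤ.+ d) ℤ.+ (- b - d) ≡ a - b
  cancelʳ = solve 3 (λ a b d → (a :+ d) :+ (:- b :- d) := a :- b) refl
  cancelˡ : ∀ (c b d : ℤ) → (c ℤ.+ b) ℤ.+ (- b - d) ≡ c - d
  cancelˡ = solve 3 (λ c b d → (c :+ b) :+ (:- b :- d) := c :- d) refl

d : ℕ → List ℕ → ℤ
d i y = (+ w (suc i) y) - (+ w i y)

-- `maxℤ zs m` is the maximum of zs and m, so it commutes with ⊔ in m.
maxℤ-⊔ : ∀ zs a b → maxℤ zs (a ℤ.⊔ b) ≡ a ℤ.⊔ maxℤ zs b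
maxℤ-⊔ []       a b = refl
maxℤ-⊔ (z ∷ zs) a b = begin
  maxℤ zs (z ℤ.⊔ (a ℤ.⊔ b)) ≡⟨ cong (maxℤ zs) (ℤₚ.⊔-assoc z a b) ⟨
  maxℤ zs ((z ℤ.⊔ a) ℤ.⊔ b) ≡⟨ cong (λ m → maxℤ zs (m ℤ.⊔ b)) (ℤₚ.⊔-comm z a) ⟩
  maxℤ zs ((a ℤ.⊔ z) ℤ.⊔ b) ≡⟨ cong (maxℤ zs) (ℤₚ.⊔-assoc a z b) ⟩
  maxℤ zs (a ℤ.⊔ (z ℤ.⊔ b)) ≡⟨ maxℤ-⊔ zs a (z ℤ.⊔ b) ⟩
  a ℤ.⊔ maxℤ zs (z ℤ.⊔ b)   ∎
  where open ≡-Reasoning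

-- The suffixes of a x are a x itself and the suffixes of x.
α-∷ : ∀ i a x → α i (a ∷ x) ≡ d i (a ∷ x) ℤ.⊔ α i x
α-∷ i a []      = ℤₚ.⊔-comm _ _
α-∷ i a (b ∷ x) = trans (cong (maxℤ (map (d i) (suffixes x))) (ℤₚ.⊔-comm _ _))
                        (maxℤ-⊔ (map (d i) (suffixes x)) _ _)

d≤α : ∀ i x → d i x ℤ.≤ α i x
d≤α i []      = ℤₚ.≤-refl
d≤α i (a ∷ x) = subst (d i (a ∷ x) ℤ.≤_) (sym (α-∷ i a x)) (ℤₚ.i≤i⊔j _ _)

α-∷-≥ : ∀ i a x → α i x ℤ.≤ α i (a ∷ x)
α-∷-≥ i a x = subst (α i x ℤ.≤_) (sym (α-∷ i a x)) (ℤₚ.i≤j⊔i _ _)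

w-∷-≡ : ∀ j x → w j (j ∷ x) ≡ suc (w j x)
w-∷-≡ j x = trans (w-∷ j j x) (cong (_+ w j x) (δ-≡ j))

w-∷-≢ : ∀ {a j} x → a ≢ j → w j (a ∷ x) ≡ w j x
w-∷-≢ {a} {j} x a≢j = trans (w-∷ j a x) (cong (_+ w j x) (δ-≢ a≢j))

-- The condition of the theorem, letter by letter

Cond : List ℕ → List ℕ → Set
Cond x p = ∀ i → 1 ≤ i → α i x ℤ.≤ (+ conjAt p i) - (+ conjAt p (suc i))

-- dᵢ(y) ≤ λ'ᵢ - λ'ᵢ₊₁ for all i ≥ 1, stated in ℕ: the sequence
-- (λ'ⱼ + wⱼ(y))ⱼ is nonincreasing from j = 1 on.
Balanced : List ℕ → List ℕ → Set
Balanced p y = ∀ i → 1 ≤ i → w (suc i) y + conjAt p (suc i) ≤ conjAt p i + w i y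

-- For the empty word this is monotonicity of columns, so Cond [] holds.
balanced-[] : ∀ p → Balanced p []
balanced-[] p i _ = subst (conjAt p (suc i) ≤_) (sym (+-identityʳ _)) (conjAt-antitone p (n≤1+n i))

-- The suffix x̃ = x of x is among those maximised over in α.
cond⇒balanced : ∀ {x p} → Cond x p → Balanced p x
cond⇒balanced {x} {p} cond i i≥1 =
  diff≤diff⇒ (w (suc i) x) (w i x) (conjAt p i) (conjAt p (suc i)) (ℤₚ.≤-trans (d≤α i x) (cond i i≥1))

cond-[] : ∀ p → Cond [] p
cond-[] p i i≥1 = ⇒diff≤diff 0 0 (conjAt p i) (conjAt p (suc i)) (balanced-[] p i i≥1)

-- Cond (a x) = Balanced (a x) ∧ Cond x, by α-∷.
cond-∷ : ∀ {a x p} → Balanced p (a ∷ x) → Cond x p → Cond (a ∷ x) p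
cond-∷ {a} {x} {p} balanced cond i i≥1 = subst (ℤ._≤ _) (sym (α-∷ i a x)) (ℤₚ.⊔-lub
  (⇒diff≤diff (w (suc i) (a ∷ x)) (w i (a ∷ x)) (conjAt p i) (conjAt p (suc i)) (balanced i i≥1))
  (cond i i≥1))

cond-tail : ∀ {a x p} → Cond (a ∷ x) p → Cond x p
cond-tail {a} {x} {p} cond i i≥1 = ℤₚ.≤-trans (α-∷-≥ i a x) (cond i i≥1)

Columns : List ℕ → List ℕ → List ℕ → Set
Columns μ p x = ∀ j → conjAt μ (suc j) ≡ conjAt p (suc j) + w (suc j) x

-- If μ = u_x(λ), the new inequalities for a x say exactly that column a of μ
-- can take a box: for i + 1 ≠ a they are those for x, and for i + 1 = a ≥ 2
-- the inequality reads μ'ₐ < μ'ₐ₋₁.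
addable⇒balanced : ∀ {a x p μ} → Balanced p x → Columns μ p x → Addable a μ → Balanced p (a ∷ x)
addable⇒balanced {a} {x} {p} {μ} balanced cols addable i@(suc i′) i≥1 with a ≟ suc i
... | no a≢i+1 rewrite w-∷-≢ x a≢i+1 | w-∷ i a x =
  ≤-trans (balanced i i≥1) (+-monoʳ-≤ (conjAt p i) (m≤n+m (w i x) (δ a i)))
... | yes refl rewrite w-∷-≡ (suc i) x | w-∷-≢ {suc i} {i} x 1+n≢n =
  subst₂ _≤_ (cong suc (trans (cols i) (+-comm (conjAt p (suc i)) (w (suc i) x)))) (cols i′)
    (column-shorter addable)
  where
  column-shorter : Addable (suc i) μ → conjAt μ (suc i) < conjAt μ i
  column-shorter (inj₂ μ'ₐ<μ'ₐ₋₁) = μ'ₐ<μ'ₐ₋₁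

-- Conversely, the inequality at i + 1 = a forces column a of μ to take a box.
balanced⇒addable : ∀ {a x p μ} → 1 ≤ a → Columns μ p x → Balanced p (a ∷ x) → Addable a μ
balanced⇒addable {suc zero}    _ _ _ = inj₁ refl
balanced⇒addable {suc (suc i)} {x} {p} {μ} _ cols balanced =
  inj₂ (subst₂ _≤_ (cong suc (trans (+-comm (w (suc (suc i)) x) _) (sym (cols (suc i))))) (sym (cols i)) at-a)
  where
  at-a : suc (w (suc (suc i)) x + conjAt p (suc (suc i))) ≤ conjAt p (suc i) + w (suc i) x
  at-a = subst₂ (λ m n → m + conjAt p (suc (suc i)) ≤ conjAt p (suc i) + n)
    (w-∷-≡ (suc (suc i)) x) (w-∷-≢ x 1+n≢n) (balanced (suc i) (s≤s z≤n))

-- The induction on the word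

data Outcome (x p : List ℕ) : Set where
  fails    : uWord x p ≡ nothing → ¬ Cond x p → Outcome x p
  succeeds : (μ : List ℕ) → uWord x p ≡ just μ → IsPartition μ → Columns μ p x → Cond x p → Outcome x p

columns-∷ : ∀ {a x p μ ν} → Columns μ p x →
  (∀ j → conjAt ν (suc j) ≡ conjAt μ (suc j) + δ a (suc j)) → Columns ν p (a ∷ x)
columns-∷ {a} {x} {p} {μ} {ν} cols step j = begin
  conjAt ν (suc j)                                 ≡⟨ step j ⟩
  conjAt μ (suc j) + δ a (suc j)                   ≡⟨ cong (_+ δ a (suc j)) (cols j) ⟩
  conjAt p (suc j) + w (suc j) x + δ a (suc j)     ≡⟨ +-assoc (conjAt p (suc j)) _ _ ⟩
  conjAt p (suc j) + (w (suc j) x + δ a (suc j))   ≡⟨ cong (_+_ (conjAt p (suc j))) (+-comm (w (suc j) x) _) ⟩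
  conjAt p (suc j) + (δ a (suc j) + w (suc j) x)   ≡⟨ cong (_+_ (conjAt p (suc j))) (w-∷ (suc j) a x) ⟨
  conjAt p (suc j) + w (suc j) (a ∷ x)             ∎
  where open ≡-Reasoning

outcome : ∀ x p → IsPartition p → All (1 ≤_) x → Outcome x p
outcome []      p partition _ = succeeds p refl partition (λ j → sym (+-identityʳ _)) (cond-[] p)
outcome (a ∷ x) p partition (a≥1 ∷ x≥1) with outcome x p partition x≥1
... | fails uₓ≡0 ¬cond = fails (cong (_>>= u a) uₓ≡0) (¬cond ∘ cond-tail {a} {x} {p})
... | succeeds μ uₓ≡μ μ-partition cols cond with addable? a μ
...   | no ¬addable =
  fails (trans (cong (_>>= u a) uₓ≡μ) (u-fails μ-partition ¬addable))
        (λ cond′ → ¬addable (balanced⇒addable {a} {x} {p} {μ} a≥1 cols (cond⇒balanced {a ∷ x} {p} cond′)))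
...   | yes addable with u-adds μ-partition a≥1 addable
...     | ν , uₐμ≡ν , ν-partition , step =
  succeeds ν (trans (cong (_>>= u a) uₓ≡μ) uₐμ≡ν) ν-partition (columns-∷ {a} {x} {p} {μ} {ν} cols step)
    (cond-∷ {a} {x} {p} (addable⇒balanced {a} {x} {p} {μ} (cond⇒balanced {x} {p} cond) cols addable) cond)

-- Recovering a partition from its columns

entries≤max : ∀ l → All (_≤ maxList l) l
entries≤max []       = []
entries≤max (a ∷ as) = m≤m⊔n a (maxList as) ∷ All.map (λ b≤ → ≤-trans b≤ (m≤n⊔m a (maxList as))) (entries≤max as)

max≤ : ∀ {M} l → All (_≤ M) l → maxList l ≤ M
max≤ []       []               = z≤n
max≤ (a ∷ as) (a≤M ∷ as≤M) = ⊔-lub a≤M (max≤ as as≤M)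

row≤max : ∀ k l → row k l ≤ maxList l
row≤max k             []       = z≤n
row≤max zero          (a ∷ as) = z≤n
row≤max (suc zero)    (a ∷ as) = m≤m⊔n a (maxList as)
row≤max (suc (suc k)) (a ∷ as) = ≤-trans (row≤max (suc k) as) (m≤n⊔m a (maxList as))

w≡0 : ∀ {j} x → All (_< j) x → w j x ≡ 0
w≡0     []      []           = refl
w≡0 {j} (a ∷ x) (a<j ∷ x<j) = trans (w-∷-≢ x (<⇒≢ a<j)) (w≡0 x x<j)

conjAt-applyUpTo : ∀ N (f : ℕ → ℕ) R m → R ≤ N → (∀ k → m ≤ f k → k < R) → (∀ k → k < R → m ≤ f k) →
  conjAt (applyUpTo f N) m ≡ R
conjAt-applyUpTo zero    f zero    m z≤n _ _ = refl
conjAt-applyUpTo (suc N) f zero    m _ only-below _ =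
  trans (conjAt-∷-< {f 0} {applyUpTo (f ∘ suc) N} {m} (λ m≤f0 → n≮0 (only-below 0 m≤f0)))
        (conjAt-applyUpTo N (f ∘ suc) 0 m z≤n (λ k m≤f → ⊥-elim (n≮0 (only-below (suc k) m≤f))) (λ k ()))
conjAt-applyUpTo (suc N) f (suc R) m (s≤s R≤N) only-below below =
  trans (conjAt-∷-≥ {f 0} {applyUpTo (f ∘ suc) N} {m} (below 0 (s≤s z≤n)))
        (cong suc (conjAt-applyUpTo N (f ∘ suc) R m R≤N
          (λ k m≤f → s≤s⁻¹ (only-below (suc k) m≤f)) (λ k k<R → below (suc k) (s≤s k<R))))

rows-applyUpTo : ∀ q → applyUpTo (λ j → row (suc j) q) (length q) ≡ q
rows-applyUpTo []       = refl
rows-applyUpTo (a ∷ as) = cong (a ∷_) (rows-applyUpTo as)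

-- The longest column of a partition is its first one, of length ℓ(q).
max-columns : ∀ q N → IsPartition q → maxList q ≤ N → maxList (applyUpTo (λ j → conjAt q (suc j)) N) ≡ length q
max-columns []       zero    _                 _    = refl
max-columns (a ∷ as) zero    (_ , (a>0 ∷ _)) q≤0 = ⊥-elim (n≮0 (≤-trans a>0 (≤-trans (m≤m⊔n a (maxList as)) q≤0)))
max-columns q        (suc N) (_ , positive)    _    =
  trans (m≥n⇒m⊔n≡m (max≤ _ (applyUpTo⁺₁ (λ k → conjAt q (suc (suc k))) N (λ _ → conjAt-antitone q (s≤s z≤n)))))
        (conjAt-1 q positive)

conj-columns : ∀ q N → IsPartition q → maxList q ≤ N → conj (map (λ j → conjAt q (suc j)) (upTo N)) ≡ q
conj-columns q N partition@(nonInc , _) q≤N = begin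
  conj (map column (upTo N))                      ≡⟨ cong conj (map-upTo column N) ⟩
  map column′ (upTo (maxList ν))                  ≡⟨ cong (λ n → map column′ (upTo n)) (max-columns q N partition q≤N) ⟩
  map column′ (upTo (length q))                   ≡⟨ map-cong column′≗row (upTo (length q)) ⟩
  map (λ j → row (suc j) q) (upTo (length q))     ≡⟨ map-upTo (λ j → row (suc j) q) (length q) ⟩
  applyUpTo (λ j → row (suc j) q) (length q)      ≡⟨ rows-applyUpTo q ⟩
  q                                               ∎
  where
  open ≡-Reasoning
  column : ℕ → ℕ
  column j = conjAt q (suc j)
  ν = applyUpTo column N
  column′ : ℕ → ℕ
  column′ j = conjAt ν (suc j)
  column′≗row : ∀ j → column′ j ≡ row (suc j) q
  column′≗row j = conjAt-applyUpTo N column (row (suc j) q) (suc j) (≤-trans (row≤max (suc j) q) q≤N)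
    (λ k → <conjAt⇒long-row nonInc j) (λ k → long-row⇒<conjAt nonInc (s≤s z≤n) j)

columns-determine : ∀ p x μ → IsPartition μ → Columns μ p x → μ ≡ conj (shiftedCols p x)
columns-determine p x μ partition cols =
  sym (trans (cong conj (map-cong (λ j → sym (cols j)) (upTo N))) (conj-columns μ N partition μ≤N))
  where
  N = maxList p + maxList x
  column-N+1-empty : conjAt μ (suc N) ≡ 0
  column-N+1-empty = trans (cols N) (cong₂ _+_
    (conjAt≡0 p (All.map (λ a≤ → s≤s (≤-trans a≤ (m≤m+n (maxList p) (maxList x)))) (entries≤max p)))
    (w≡0 x (All.map (λ a≤ → s≤s (≤-trans a≤ (m≤n+m (maxList x) (maxList p)))) (entries≤max x))))
  μ≤N : maxList μ ≤ N
  μ≤N = max≤ μ (All.map s≤s⁻¹ (conjAt≡0⁻ μ column-N+1-empty))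

mainTheorem3 : (λ′ x : List ℕ) → IsPartition λ′ → All (1 ≤_) x →
    ((∀ i → 1 ≤ i → α i x ℤ.≤ (+ conjAt λ′ i) - (+ conjAt λ′ (ℕ.suc i))) →
      uWord x λ′ ≡ just (conj (shiftedCols λ′ x)))
    × (¬ (∀ i → 1 ≤ i → α i x ℤ.≤ (+ conjAt λ′ i) - (+ conjAt λ′ (ℕ.suc i))) →
      uWord x λ′ ≡ nothing)
mainTheorem3 λ′ x partition letters≥1 with outcome x λ′ partition letters≥1
... | fails uₓ≡0 ¬cond = (λ cond → ⊥-elim (¬cond cond)) , (λ _ → uₓ≡0)
... | succeeds μ uₓ≡μ μ-partition cols cond =
  (λ _ → trans uₓ≡μ (cong just (columns-determine λ′ x μ μ-partition cols))) , (λ ¬cond → ⊥-elim (¬cond cond))
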